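{- Let $G$ be a stem group of Hall's isoclinism family $\Phi_6$ for $p=5$, presented as $G=\langle x,y\rangle$, with maximal subgroups $H_1=\langle y,G'\rangle$ and $H_i=\langle xy^{i-2},G'\rangle$ for $2\le i\le 6$, and let $\mathrm{T}_i:G/G'\to H_i/H_i'$ denote the transfer. Then for every $1\le i\le6$ and every $0\le j,\ell\le4$, $\mathrm{T}_i(x^jy^\ell G')=x^{5j}y^{5\ell}H_i'$.
   Context: The stem groups of $\Phi_6$ for $p=5$ are the $5$-groups $G$ of order $5^5$, nilpotency class $3$ and coclass $2$ of the following form: $G=\langle x,y\rangle$, $s_2=[y,x]$, $s_3=[s_2,x]$, $t_3=[s_2,y]$, $s_2^5=s_3^5=t_3^5=1$, $\gamma_2(G)=G'=\langle s_2,s_3,t_3\rangle\simeq C_5^3$, $\gamma_3(G)=\langle s_3,t_3\rangle\simeq C_5^2$, $\gamma_4(G)=1$, centre $\zeta_1(G)=\gamma_3(G)$, $G/G'\simeq C_5\times C_5$. Every element of $G/G'$ has the form $x^jy^\ell G'$ with $0\le j,\ell\le4$. -}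

module Defs where

open import Level using (Level; _⊔_; Lift)
open import Algebra.Bundles using (Group)
open import Data.Nat using (ℕ; zero; suc; _*_)
open import Data.Fin using (Fin; zero; suc; toℕ)
open import Data.Product using (Σ; ∃; ∃₂; _×_; _,_)
open import Data.Sum using (_⊎_)
open import Data.Unit using (⊤)
open import Relation.Binary.PropositionalEquality using (_≡_)

module GroupDefs {c ℓ : Level} (G : Group c ℓ) where
  open Group G

  Pred : Set (Level.suc (c ⊔ ℓ))
  Pred = Carrier → Set (c ⊔ ℓ)

  Is : Carrier → Pred
  Is a b = Lift c (b ≈ a)

  pow : Carrier → ℕ → Carrier
  pow g zero = ε
  pow g (suc n) = g ∙ pow g n

  ⁅_,_⁆ : Carrier → Carrier → Carrier
  ⁅ a , b ⁆ = a ⁻¹ ∙ b ⁻¹ ∙ a ∙ b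

  data Gen (P : Pred) : Pred where
    gen : ∀ {g} → P g → Gen P g
    one : Gen P ε
    inv : ∀ {g} → Gen P g → Gen P (g ⁻¹)
    mul : ∀ {g h} → Gen P g → Gen P h → Gen P (g ∙ h)
    resp : ∀ {g h} → g ≈ h → Gen P g → Gen P h

  Comms : Pred → Pred → Pred
  Comms P Q g = ∃₂ λ a b → P a × Q b × g ≈ ⁅ a , b ⁆

  CommSub : Pred → Pred → Pred
  CommSub P Q = Gen (Comms P Q)

  Derived : Pred → Pred
  Derived H = CommSub H H

  Whole : Pred
  Whole _ = Lift (c ⊔ ℓ) ⊤

  γ₂ γ₃ γ₄ : Pred
  γ₂ = CommSub Whole Whole
  γ₃ = CommSub γ₂ Whole
  γ₄ = CommSub γ₃ Whole

  Centre : Pred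
  Centre z = ∀ g → z ∙ g ≈ g ∙ z

  prod : ∀ {n} → (Fin n → Carrier) → Carrier
  prod {zero} f = ε
  prod {suc n} f = f zero ∙ prod (λ k → f (suc k))

  HasOrder : Pred → ℕ → Set (c ⊔ ℓ)
  HasOrder P n = Σ (Fin n → Carrier) λ e →
      (∀ k → P (e k))
    × (∀ k k′ → e k ≈ e k′ → k ≡ k′)
    × (∀ g → P g → ∃ λ k → g ≈ e k)

  IsElemAb5 : Pred → ℕ → Set (c ⊔ ℓ)
  IsElemAb5 P r =
      (∀ g h → P g → P h → g ∙ h ≈ h ∙ g)
    × (∀ g → P g → pow g 5 ≈ ε)
    × HasOrder P (pow5 r)
    where
    pow5 : ℕ → ℕ
    pow5 zero = 1
    pow5 (suc m) = 5 * pow5 m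

  IsLeftTransversal : Pred → ∀ {n} → (Fin n → Carrier) → Set (c ⊔ ℓ)
  IsLeftTransversal H {n} t =
      (∀ g → ∃ λ k → ∃ λ h → H h × g ≈ t k ∙ h)
    × (∀ k k′ h h′ → H h → H h′ → t k ∙ h ≈ t k′ ∙ h′ → k ≡ k′)

  -- Transfer G/G' → H/H' : with respect to a left transversal t of H,
  -- g t_k = t_{σ k} h_k with h_k ∈ H, and T(g G') = (∏ h_k) H'.
  -- "T(g G') = v H'" : for every such decomposition, (∏ h_k)⁻¹ v ∈ H'.
  TransferIs : Pred → ∀ {n} → (Fin n → Carrier) → Carrier → Carrier → Set (c ⊔ ℓ)
  TransferIs H {n} t g v =
    (σ : Fin n → Fin n) (hs : Fin n → Carrier) →
    (∀ k → H (hs k) × (g ∙ t k ≈ t (σ k) ∙ hs k)) →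
    Derived H (prod hs ⁻¹ ∙ v)

  s₂ᶠ s₃ᶠ t₃ᶠ : Carrier → Carrier → Carrier
  s₂ᶠ x y = ⁅ y , x ⁆
  s₃ᶠ x y = ⁅ s₂ᶠ x y , x ⁆
  t₃ᶠ x y = ⁅ s₂ᶠ x y , y ⁆

  record IsΦ₆Stem5 (x y : Carrier) : Set (c ⊔ ℓ) where
    field
      order      : HasOrder Whole 3125
      generated  : ∀ g → Gen (λ a → Is (x) a ⊎ Is (y) a) g
      s₂⁵        : pow (s₂ᶠ x y) 5 ≈ ε
      s₃⁵        : pow (s₃ᶠ x y) 5 ≈ ε
      t₃⁵        : pow (t₃ᶠ x y) 5 ≈ ε
      γ₂-gen     : ∀ g → (γ₂ g → Gen (λ a → Is (s₂ᶠ x y) a ⊎ Is (s₃ᶠ x y) a ⊎ Is (t₃ᶠ x y) a) g)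
                         × (Gen (λ a → Is (s₂ᶠ x y) a ⊎ Is (s₃ᶠ x y) a ⊎ Is (t₃ᶠ x y) a) g → γ₂ g)
      γ₂-C5³     : IsElemAb5 γ₂ 3
      γ₃-gen     : ∀ g → (γ₃ g → Gen (λ a → Is (s₃ᶠ x y) a ⊎ Is (t₃ᶠ x y) a) g)
                         × (Gen (λ a → Is (s₃ᶠ x y) a ⊎ Is (t₃ᶠ x y) a) g → γ₃ g)
      γ₃-C5²     : IsElemAb5 γ₃ 2
      γ₄-trivial : ∀ g → γ₄ g → g ≈ ε
      centre     : ∀ g → (Centre g → γ₃ g) × (γ₃ g → Centre g)
      x⁵∈G'      : γ₂ (pow x 5)
      y⁵∈G'      : γ₂ (pow y 5)
      abelianisation : ∀ g → ∃₂ λ (j ℓ′ : Fin 5) → γ₂ ((pow x (toℕ j) ∙ pow y (toℕ ℓ′)) ⁻¹ ∙ g)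
      abelianisation-unique : ∀ (j ℓ′ j′ ℓ″ : Fin 5) →
        γ₂ ((pow x (toℕ j) ∙ pow y (toℕ ℓ′)) ⁻¹ ∙ (pow x (toℕ j′) ∙ pow y (toℕ ℓ″))) →
        (j ≡ j′) × (ℓ′ ≡ ℓ″)

  -- generator of the maximal subgroup H_i (i = 1..6 encoded as Fin 6 = 0..5):
  -- H₁ = ⟨y, G'⟩, H_i = ⟨x y^{i-2}, G'⟩ for 2 ≤ i ≤ 6
  maxGen : Carrier → Carrier → Fin 6 → Carrier
  maxGen x y zero = y
  maxGen x y (suc m) = x ∙ pow y (toℕ m)

  MaxSub : Carrier → Carrier → Fin 6 → Pred
  MaxSub x y i = Gen (λ a → Is (maxGen x y i) a ⊎ γ₂ a)

module Submission where

-- The proof rests on two general facts.  (1) A two-generated group of class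
-- at most three satisfies (ab)ⁿ = aⁿ bⁿ c^C(n,2) d^C(n,3) e^(C(n,2)+2C(n,3))
-- with c = [b,a], d = [c,a], e = [c,b]; since G′ has exponent 5 and γ₃ is
-- central, G is 5-abelian: (ab)⁵ = a⁵ b⁵.  (2) If H ⊇ G′ and G/H is cyclic of
-- order n generated by wH, then in an n-abelian group the transfer into H is
-- the n-th power map, g ↦ gⁿ H′, for every left transversal.  This is proved
-- in the commutative monoid H/H′ after writing each transversal element as
-- wᵃ m with m ∈ H.

open import Defs
open import Level using (Level; lift; _⊔_)
open import Algebra.Bundles using (Group; Monoid; CommutativeMonoid)
open import Algebra.Bundles.Raw using (RawMonoid)
open import Data.Nat using (ℕ; zero; suc; _+_; _*_; _∸_; NonZero)
open import Data.Nat.DivMod using (DivMod; _divMod_)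
import Data.Nat.Properties as ℕ
open import Data.Fin using (Fin; zero; suc; toℕ; punchOut)
open import Data.Fin.Properties using (any?; punchOut-injective; <⇒notInjective; toℕ<n) renaming (_≟_ to _≟ᶠ_)
open import Data.Fin.Permutation using (Permutation; permutation; _⟨$⟩ʳ_)
open import Data.Product using (Σ; ∃; _×_; _,_; proj₁; proj₂)
open import Data.Sum using (_⊎_; inj₁; inj₂)
open import Data.Unit using (tt)
open import Function using (_∘_; Injective)
open import Relation.Nullary using (yes; no)
open import Data.Empty using (⊥-elim)
open import Relation.Binary.PropositionalEquality as ≡ using (_≡_; _≢_)
import Algebra.Properties.CommutativeMonoid.Sum as CommutativeMonoidSum

-- An injective endomap of a finite set is onto: otherwise, punching out a
-- missed value would inject Fin (suc m) into Fin m.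
injective⇒surjective : ∀ {n} (f : Fin n → Fin n) → Injective _≡_ _≡_ f →
                       ∀ y → ∃ λ k → f k ≡ y
injective⇒surjective {suc m} f f-inj y with any? (λ k → f k ≟ᶠ y)
... | yes hit = hit
... | no miss = ⊥-elim (<⇒notInjective (ℕ.n<1+n m) squeeze-inj)
  where
  missed : ∀ k → y ≢ f k
  missed k y≡fk = miss (k , ≡.sym y≡fk)
  squeeze : Fin (suc m) → Fin m
  squeeze k = punchOut (missed k)
  squeeze-inj : Injective _≡_ _≡_ squeeze
  squeeze-inj {k} {k′} eq = f-inj (punchOut-injective (missed k) (missed k′) eq)

injective⇒permutation : ∀ {n} (f : Fin n → Fin n) → Injective _≡_ _≡_ f →
                        Σ (Permutation n n) λ π → ∀ k → π ⟨$⟩ʳ k ≡ f k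
injective⇒permutation f f-inj =
  permutation f f⁻¹ (λ y → proj₂ (onto y)) (λ k → f-inj (proj₂ (onto (f k)))) , λ _ → ≡.refl
  where
  onto = injective⇒surjective f f-inj
  f⁻¹ = λ y → proj₁ (onto y)

module Reindex {c ℓ : Level} (M : CommutativeMonoid c ℓ) where
  open CommutativeMonoid M
  open CommutativeMonoidSum M using (sum; sum-permute; sum-cong-≗)

  sum-reindex : ∀ {n} (f : Fin n → Carrier) (τ : Fin n → Fin n) →
                Injective _≡_ _≡_ τ → sum f ≈ sum (f ∘ τ)
  sum-reindex f τ τ-inj = trans (sum-permute f π)
    (reflexive (sum-cong-≗ (λ k → ≡.cong f (π≗τ k))))
    where
    π = proj₁ (injective⇒permutation τ τ-inj)
    π≗τ = proj₂ (injective⇒permutation τ τ-inj)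

module ℕSum = CommutativeMonoidSum ℕ.+-0-commutativeMonoid

sum-shift : ∀ {n} (E : ℕ) (f : Fin n → ℕ) → ℕSum.sum (λ k → E + f k) ≡ n * E + ℕSum.sum f
sum-shift {n} E f = ≡.trans (ℕSum.∑-distrib-+ (λ _ → E) f)
  (≡.cong (_+ ℕSum.sum f) (sum-const n))
  where
  sum-const : ∀ m → ℕSum.sum (λ (_ : Fin m) → E) ≡ m * E
  sum-const zero = ≡.refl
  sum-const (suc m) = ≡.cong (E +_) (sum-const m)

module SolverSyntax {c ℓ : Level} (M : RawMonoid c ℓ) where
  open import Algebra.Solver.Monoid.Expression M public using (id)
  open import Algebra.Solver.Monoid.Expression M using (_⊕_; Expr)

  infixl 7 _⊛_
  _⊛_ : ∀ {n} → Expr n → Expr n → Expr n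
  _⊛_ = _⊕_

module MonoidSolver {c ℓ : Level} (M : Monoid c ℓ) where
  open import Algebra.Solver.Monoid M public using (solve; _⊜_)
  open SolverSyntax (Monoid.rawMonoid M) public

module GroupFacts {c ℓ : Level} (G : Group c ℓ) where
  open Group G
  open GroupDefs G
  -- cancelˡ a b : a⁻¹(ab) ≈ b,  cancelˡ′ a b : a(a⁻¹b) ≈ b,
  -- cancelʳ b a : ab b⁻¹ ≈ a,   cancelʳ′ b a : ab⁻¹ b ≈ a.
  open import Algebra.Properties.Group G public
    using (⁻¹-anti-homo-∙; ⁻¹-involutive; ε⁻¹≈ε)
    renaming ( \\-leftDividesʳ to cancelˡ; \\-leftDividesˡ to cancelˡ′
             ; //-rightDividesʳ to cancelʳ; //-rightDividesˡ to cancelʳ′)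
  import Algebra.Properties.Monoid.Mult monoid as Mult
  open import Relation.Binary.Reasoning.Setoid setoid
  open MonoidSolver monoid

  pow≡× : ∀ g n → pow g n ≡ n Mult.× g
  pow≡× g zero = ≡.refl
  pow≡× g (suc n) = ≡.cong (g ∙_) (pow≡× g n)

  pow-cong : ∀ {a b} n → a ≈ b → pow a n ≈ pow b n
  pow-cong {a} {b} n a≈b rewrite pow≡× a n | pow≡× b n = Mult.×-congʳ n a≈b

  pow-≡ : ∀ g {m n} → m ≡ n → pow g m ≈ pow g n
  pow-≡ g m≡n = reflexive (≡.cong (pow g) m≡n)

  pow-+ : ∀ g m n → pow g (m + n) ≈ pow g m ∙ pow g n
  pow-+ g m n rewrite pow≡× g (m + n) | pow≡× g m | pow≡× g n = Mult.×-homo-+ g m n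

  pow-* : ∀ g n m → pow g (n * m) ≈ pow (pow g m) n
  pow-* g n m rewrite pow≡× g (n * m) | pow≡× (pow g m) n | pow≡× g m = sym (Mult.×-assocˡ g n m)

  pow-sucʳ : ∀ g n → pow g (suc n) ≈ pow g n ∙ g
  pow-sucʳ g n = begin
    pow g (suc n)     ≡⟨ ≡.cong (pow g) (ℕ.+-comm 1 n) ⟩
    pow g (n + 1)     ≈⟨ pow-+ g n 1 ⟩
    pow g n ∙ (g ∙ ε) ≈⟨ ∙-congˡ (identityʳ g) ⟩
    pow g n ∙ g       ∎

  pow-ε : ∀ n → pow ε n ≈ ε
  pow-ε zero = refl
  pow-ε (suc n) = trans (identityˡ _) (pow-ε n)

  pow-inv : ∀ g n → pow (g ⁻¹) n ≈ pow g n ⁻¹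
  pow-inv g zero = sym ε⁻¹≈ε
  pow-inv g (suc n) = begin
    g ⁻¹ ∙ pow (g ⁻¹) n ≈⟨ ∙-congˡ (pow-inv g n) ⟩
    g ⁻¹ ∙ pow g n ⁻¹   ≈⟨ ⁻¹-anti-homo-∙ (pow g n) g ⟨
    (pow g n ∙ g) ⁻¹    ≈⟨ ⁻¹-cong (pow-sucʳ g n) ⟨
    pow g (suc n) ⁻¹    ∎

  pow-pow-comm : ∀ g m n → pow g m ∙ pow g n ≈ pow g n ∙ pow g m
  pow-pow-comm g m n = trans (sym (pow-+ g m n)) (trans (pow-≡ g (ℕ.+-comm m n)) (pow-+ g n m))

  comm-inv : ∀ a b → a ∙ b ≈ b ∙ a → a ∙ b ⁻¹ ≈ b ⁻¹ ∙ a
  comm-inv a b ab≈ba = begin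
    a ∙ b ⁻¹               ≈⟨ cancelˡ b (a ∙ b ⁻¹) ⟨
    b ⁻¹ ∙ (b ∙ (a ∙ b ⁻¹)) ≈⟨ ∙-congˡ (assoc b a (b ⁻¹)) ⟨
    b ⁻¹ ∙ (b ∙ a ∙ b ⁻¹)   ≈⟨ ∙-congˡ (∙-congʳ ab≈ba) ⟨
    b ⁻¹ ∙ (a ∙ b ∙ b ⁻¹)   ≈⟨ ∙-congˡ (cancelʳ b a) ⟩
    b ⁻¹ ∙ a               ∎

  pow-comm : ∀ a b n → a ∙ b ≈ b ∙ a → pow a n ∙ b ≈ b ∙ pow a n
  pow-comm a b zero _ = trans (identityˡ b) (sym (identityʳ b))
  pow-comm a b (suc n) ab≈ba = begin
    a ∙ pow a n ∙ b   ≈⟨ assoc a (pow a n) b ⟩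
    a ∙ (pow a n ∙ b) ≈⟨ ∙-congˡ (pow-comm a b n ab≈ba) ⟩
    a ∙ (b ∙ pow a n) ≈⟨ assoc a b (pow a n) ⟨
    a ∙ b ∙ pow a n   ≈⟨ ∙-congʳ ab≈ba ⟩
    b ∙ a ∙ pow a n   ≈⟨ assoc b a (pow a n) ⟩
    b ∙ (a ∙ pow a n) ∎

  centre-pow : ∀ z n → Centre z → Centre (pow z n)
  centre-pow z n z-central g = pow-comm z g n (z-central g)

  centre-∙ : ∀ z z′ → Centre z → Centre z′ → Centre (z ∙ z′)
  centre-∙ z z′ z-central z′-central g = begin
    z ∙ z′ ∙ g   ≈⟨ assoc z z′ g ⟩
    z ∙ (z′ ∙ g) ≈⟨ ∙-congˡ (z′-central g) ⟩
    z ∙ (g ∙ z′) ≈⟨ assoc z g z′ ⟨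
    z ∙ g ∙ z′   ≈⟨ ∙-congʳ (z-central g) ⟩
    g ∙ z ∙ z′   ≈⟨ assoc g z z′ ⟩
    g ∙ (z ∙ z′) ∎

  centre-shift : ∀ a z b → Centre z → a ∙ z ∙ b ≈ a ∙ b ∙ z
  centre-shift a z b z-central =
    trans (assoc a z b) (trans (∙-congˡ (z-central b)) (sym (assoc a b z)))

  swap : ∀ a b → b ∙ a ≈ a ∙ b ∙ ⁅ b , a ⁆
  swap a b = sym (begin
    a ∙ b ∙ (b ⁻¹ ∙ a ⁻¹ ∙ b ∙ a)
      ≈⟨ solve 5 (λ A B B′ A′ B₂ → A ⊛ B ⊛ (B′ ⊛ A′ ⊛ B₂ ⊛ A) ⊜ A ⊛ (B ⊛ B′) ⊛ A′ ⊛ (B₂ ⊛ A))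
               refl a b (b ⁻¹) (a ⁻¹) b ⟩
    a ∙ (b ∙ b ⁻¹) ∙ a ⁻¹ ∙ (b ∙ a) ≈⟨ ∙-congʳ (∙-congʳ (∙-congˡ (inverseʳ b))) ⟩
    a ∙ ε ∙ a ⁻¹ ∙ (b ∙ a)          ≈⟨ ∙-congʳ (∙-congʳ (identityʳ a)) ⟩
    a ∙ a ⁻¹ ∙ (b ∙ a)              ≈⟨ ∙-congʳ (inverseʳ a) ⟩
    ε ∙ (b ∙ a)                     ≈⟨ identityˡ (b ∙ a) ⟩
    b ∙ a                           ∎)

  conj-comm : ∀ a b → a ⁻¹ ∙ b ∙ a ≈ b ∙ ⁅ b , a ⁆
  conj-comm a b = begin
    a ⁻¹ ∙ b ∙ a                  ≈⟨ assoc (a ⁻¹) b a ⟩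
    a ⁻¹ ∙ (b ∙ a)                ≈⟨ ∙-congˡ (swap a b) ⟩
    a ⁻¹ ∙ (a ∙ b ∙ ⁅ b , a ⁆)    ≈⟨ ∙-congˡ (assoc a b _) ⟩
    a ⁻¹ ∙ (a ∙ (b ∙ ⁅ b , a ⁆))  ≈⟨ cancelˡ a _ ⟩
    b ∙ ⁅ b , a ⁆                 ∎

  -- Conjugation is multiplicative, so it commutes with powers.
  conj-pow : ∀ a b n → a ⁻¹ ∙ pow b n ∙ a ≈ pow (a ⁻¹ ∙ b ∙ a) n
  conj-pow a b zero = trans (∙-congʳ (identityʳ (a ⁻¹))) (inverseˡ a)
  conj-pow a b (suc n) = begin
    a ⁻¹ ∙ (b ∙ pow b n) ∙ a
      ≈⟨ ∙-congʳ (∙-congˡ (∙-congʳ (cancelʳ a b))) ⟨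
    a ⁻¹ ∙ (b ∙ a ∙ a ⁻¹ ∙ pow b n) ∙ a
      ≈⟨ solve 4 (λ A′ B A P → A′ ⊛ (B ⊛ A ⊛ A′ ⊛ P) ⊛ A ⊜ (A′ ⊛ B ⊛ A) ⊛ (A′ ⊛ P ⊛ A))
               refl (a ⁻¹) b a (pow b n) ⟩
    (a ⁻¹ ∙ b ∙ a) ∙ (a ⁻¹ ∙ pow b n ∙ a) ≈⟨ ∙-congˡ (conj-pow a b n) ⟩
    (a ⁻¹ ∙ b ∙ a) ∙ pow (a ⁻¹ ∙ b ∙ a) n ∎

-- Exponents in the product formula for groups of class three:
-- binom₂ n = C(n,2), binom₃ n = C(n,3) and mixed n = C(n,2) + 2·C(n,3).
binom₂ binom₃ mixed : ℕ → ℕ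
binom₂ zero = 0
binom₂ (suc n) = n + binom₂ n
binom₃ zero = 0
binom₃ (suc n) = binom₂ n + binom₃ n
mixed zero = 0
mixed (suc n) = (n + binom₂ n) + (binom₂ n + mixed n)

module ClassThreePowers {c ℓ : Level} (G : Group c ℓ) where
  open Group G
  open GroupDefs G
  open GroupFacts G
  open import Relation.Binary.Reasoning.Setoid setoid
  open MonoidSolver monoid

  power-past : ∀ u z f → Centre f → u ∙ z ≈ z ∙ u ∙ f →
               ∀ m → pow u m ∙ z ≈ z ∙ pow u m ∙ pow f m
  power-past u z f f-central uz≈zuf zero =
    trans (identityˡ z) (sym (trans (identityʳ _) (identityʳ z)))
  power-past u z f f-central uz≈zuf (suc m) = begin
    u ∙ pow u m ∙ z               ≈⟨ assoc u (pow u m) z ⟩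
    u ∙ (pow u m ∙ z)             ≈⟨ ∙-congˡ (power-past u z f f-central uz≈zuf m) ⟩
    u ∙ (z ∙ pow u m ∙ pow f m)   ≈⟨ solve 4 (λ U Z P Q → U ⊛ (Z ⊛ P ⊛ Q) ⊜ U ⊛ Z ⊛ P ⊛ Q) refl u z (pow u m) (pow f m) ⟩
    u ∙ z ∙ pow u m ∙ pow f m     ≈⟨ ∙-congʳ (∙-congʳ uz≈zuf) ⟩
    z ∙ u ∙ f ∙ pow u m ∙ pow f m ≈⟨ ∙-congʳ (centre-shift (z ∙ u) f (pow u m) f-central) ⟩
    z ∙ u ∙ pow u m ∙ f ∙ pow f m ≈⟨ solve 5 (λ Z U P F Q → Z ⊛ U ⊛ P ⊛ F ⊛ Q ⊜ Z ⊛ (U ⊛ P) ⊛ (F ⊛ Q)) refl z u (pow u m) f (pow f m) ⟩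
    z ∙ (u ∙ pow u m) ∙ (f ∙ pow f m) ∎

  class-two-power : ∀ b c e → Centre e → c ∙ b ≈ b ∙ c ∙ e →
                    ∀ m → pow (b ∙ c) m ≈ pow b m ∙ pow c m ∙ pow e (binom₂ m)
  class-two-power b c e e-central cb≈bce zero = sym (trans (identityʳ _) (identityʳ ε))
  class-two-power b c e e-central cb≈bce (suc m) = begin
    pow (b ∙ c) (suc m)          ≈⟨ pow-sucʳ (b ∙ c) m ⟩
    pow (b ∙ c) m ∙ (b ∙ c)      ≈⟨ ∙-congʳ (class-two-power b c e e-central cb≈bce m) ⟩
    Bm ∙ Cm ∙ Eα ∙ (b ∙ c)       ≈⟨ centre-shift (Bm ∙ Cm) Eα (b ∙ c) (centre-pow e (binom₂ m) e-central) ⟩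
    Bm ∙ Cm ∙ (b ∙ c) ∙ Eα       ≈⟨ solve 5 (λ P Q B C R → P ⊛ Q ⊛ (B ⊛ C) ⊛ R ⊜ P ⊛ (Q ⊛ B) ⊛ C ⊛ R) refl Bm Cm b c Eα ⟩
    Bm ∙ (Cm ∙ b) ∙ c ∙ Eα       ≈⟨ ∙-congʳ (∙-congʳ (∙-congˡ (power-past c b e e-central cb≈bce m))) ⟩
    Bm ∙ (b ∙ Cm ∙ Em) ∙ c ∙ Eα  ≈⟨ solve 6 (λ P B Q R C S → P ⊛ (B ⊛ Q ⊛ R) ⊛ C ⊛ S ⊜ P ⊛ B ⊛ Q ⊛ (R ⊛ C) ⊛ S) refl Bm b Cm Em c Eα ⟩
    Bm ∙ b ∙ Cm ∙ (Em ∙ c) ∙ Eα   ≈⟨ ∙-congʳ (∙-congˡ (centre-pow e m e-central c)) ⟩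
    Bm ∙ b ∙ Cm ∙ (c ∙ Em) ∙ Eα   ≈⟨ solve 6 (λ P B Q C R S → P ⊛ B ⊛ Q ⊛ (C ⊛ R) ⊛ S ⊜ (P ⊛ B) ⊛ (Q ⊛ C) ⊛ (R ⊛ S)) refl Bm b Cm c Em Eα ⟩
    (Bm ∙ b) ∙ (Cm ∙ c) ∙ (Em ∙ Eα)
      ≈⟨ ∙-cong (∙-cong (pow-sucʳ b m) (pow-sucʳ c m)) (pow-+ e m (binom₂ m)) ⟨
    pow b (suc m) ∙ pow c (suc m) ∙ pow e (binom₂ (suc m)) ∎
    where
    Bm = pow b m
    Cm = pow c m
    Em = pow e m
    Eα = pow e (binom₂ m)

  module _ (a b : Carrier)
           (d-central : Centre ⁅ ⁅ b , a ⁆ , a ⁆) (e-central : Centre ⁅ ⁅ b , a ⁆ , b ⁆) where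
    private
      c′ d′ e′ : Carrier
      c′ = ⁅ b , a ⁆
      d′ = ⁅ c′ , a ⁆
      e′ = ⁅ c′ , b ⁆

    -- bⁿ a = a bⁿ cⁿ e^C(n,2), since a⁻¹ bⁿ a = (a⁻¹ b a)ⁿ = (b c)ⁿ.
    power-past-a : ∀ n → pow b n ∙ a ≈ a ∙ pow b n ∙ pow c′ n ∙ pow e′ (binom₂ n)
    power-past-a n = begin
      pow b n ∙ a                        ≈⟨ cancelˡ′ a (pow b n ∙ a) ⟨
      a ∙ (a ⁻¹ ∙ (pow b n ∙ a))         ≈⟨ ∙-congˡ (assoc (a ⁻¹) (pow b n) a) ⟨
      a ∙ (a ⁻¹ ∙ pow b n ∙ a)           ≈⟨ ∙-congˡ (conj-pow a b n) ⟩
      a ∙ pow (a ⁻¹ ∙ b ∙ a) n           ≈⟨ ∙-congˡ (pow-cong n (conj-comm a b)) ⟩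
      a ∙ pow (b ∙ c′) n                 ≈⟨ ∙-congˡ (class-two-power b c′ e′ e-central (swap b c′) n) ⟩
      a ∙ (pow b n ∙ pow c′ n ∙ pow e′ (binom₂ n))
        ≈⟨ solve 4 (λ A B C E → A ⊛ (B ⊛ C ⊛ E) ⊜ A ⊛ B ⊛ C ⊛ E) refl a (pow b n) (pow c′ n) (pow e′ (binom₂ n)) ⟩
      a ∙ pow b n ∙ pow c′ n ∙ pow e′ (binom₂ n) ∎

    step-past-a : ∀ n → pow b n ∙ pow c′ (binom₂ n) ∙ a ≈
                  a ∙ pow b n ∙ pow c′ (binom₂ (suc n)) ∙ (pow e′ (binom₂ n) ∙ pow d′ (binom₂ n))
    step-past-a n = begin
      Bn ∙ Cα ∙ a            ≈⟨ assoc Bn Cα a ⟩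
      Bn ∙ (Cα ∙ a)          ≈⟨ ∙-congˡ (power-past c′ a d′ d-central (swap a c′) (binom₂ n)) ⟩
      Bn ∙ (a ∙ Cα ∙ Dα)     ≈⟨ solve 4 (λ B A C D → B ⊛ (A ⊛ C ⊛ D) ⊜ B ⊛ A ⊛ C ⊛ D) refl Bn a Cα Dα ⟩
      Bn ∙ a ∙ Cα ∙ Dα       ≈⟨ ∙-congʳ (∙-congʳ (power-past-a n)) ⟩
      a ∙ Bn ∙ Cn ∙ Eα ∙ Cα ∙ Dα
        ≈⟨ ∙-congʳ (centre-shift (a ∙ Bn ∙ Cn) Eα Cα (centre-pow e′ (binom₂ n) e-central)) ⟩
      a ∙ Bn ∙ Cn ∙ Cα ∙ Eα ∙ Dα
        ≈⟨ solve 6 (λ A B C C₂ E D → A ⊛ B ⊛ C ⊛ C₂ ⊛ E ⊛ D ⊜ A ⊛ B ⊛ (C ⊛ C₂) ⊛ (E ⊛ D)) refl a Bn Cn Cα Eα Dα ⟩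
      a ∙ Bn ∙ (Cn ∙ Cα) ∙ (Eα ∙ Dα) ≈⟨ ∙-congʳ (∙-congˡ (pow-+ c′ n (binom₂ n))) ⟨
      a ∙ Bn ∙ pow c′ (binom₂ (suc n)) ∙ (Eα ∙ Dα) ∎
      where
      Bn = pow b n
      Cn = pow c′ n
      Cα = pow c′ (binom₂ n)
      Dα = pow d′ (binom₂ n)
      Eα = pow e′ (binom₂ n)

    central-step : ∀ n →
      pow e′ (binom₂ (suc n)) ∙ ((pow e′ (binom₂ n) ∙ pow d′ (binom₂ n)) ∙ (pow d′ (binom₃ n) ∙ pow e′ (mixed n)))
        ≈ pow d′ (binom₃ (suc n)) ∙ pow e′ (mixed (suc n))
    central-step n = begin
      Es ∙ (Eα ∙ Dα ∙ (Dβ ∙ Eγ)) ≈⟨ ∙-congˡ (∙-congʳ (Eα-central Dα)) ⟩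
      Es ∙ (Dα ∙ Eα ∙ (Dβ ∙ Eγ)) ≈⟨ solve 5 (λ S D E B Γ → S ⊛ (D ⊛ E ⊛ (B ⊛ Γ)) ⊜ S ⊛ (D ⊛ (E ⊛ B) ⊛ Γ)) refl Es Dα Eα Dβ Eγ ⟩
      Es ∙ (Dα ∙ (Eα ∙ Dβ) ∙ Eγ) ≈⟨ ∙-congˡ (∙-congʳ (∙-congˡ (Eα-central Dβ))) ⟩
      Es ∙ (Dα ∙ (Dβ ∙ Eα) ∙ Eγ) ≈⟨ solve 5 (λ S D B E Γ → S ⊛ (D ⊛ (B ⊛ E) ⊛ Γ) ⊜ S ⊛ (D ⊛ B) ⊛ (E ⊛ Γ)) refl Es Dα Dβ Eα Eγ ⟩
      Es ∙ (Dα ∙ Dβ) ∙ (Eα ∙ Eγ) ≈⟨ ∙-congʳ (centre-pow e′ (binom₂ (suc n)) e-central (Dα ∙ Dβ)) ⟩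
      Dα ∙ Dβ ∙ Es ∙ (Eα ∙ Eγ)   ≈⟨ solve 4 (λ D B S E → D ⊛ B ⊛ S ⊛ E ⊜ (D ⊛ B) ⊛ (S ⊛ E)) refl Dα Dβ Es (Eα ∙ Eγ) ⟩
      (Dα ∙ Dβ) ∙ (Es ∙ (Eα ∙ Eγ))
        ≈⟨ ∙-cong (pow-+ d′ (binom₂ n) (binom₃ n)) (∙-congˡ (pow-+ e′ (binom₂ n) (mixed n))) ⟨
      pow d′ (binom₃ (suc n)) ∙ (Es ∙ pow e′ (binom₂ n + mixed n))
        ≈⟨ ∙-congˡ (pow-+ e′ (binom₂ (suc n)) (binom₂ n + mixed n)) ⟨
      pow d′ (binom₃ (suc n)) ∙ pow e′ (mixed (suc n)) ∎
      where
      Es = pow e′ (binom₂ (suc n))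
      Eα = pow e′ (binom₂ n)
      Dα = pow d′ (binom₂ n)
      Dβ = pow d′ (binom₃ n)
      Eγ = pow e′ (mixed n)
      Eα-central = centre-pow e′ (binom₂ n) e-central

    product-power : ∀ n → pow (a ∙ b) n ≈
      pow a n ∙ pow b n ∙ pow ⁅ b , a ⁆ (binom₂ n) ∙
        (pow ⁅ ⁅ b , a ⁆ , a ⁆ (binom₃ n) ∙ pow ⁅ ⁅ b , a ⁆ , b ⁆ (mixed n))
    product-power zero = sym (trans (∙-cong (trans (identityʳ _) (identityʳ ε)) (identityʳ ε)) (identityʳ ε))
    product-power (suc n) = begin
      pow (a ∙ b) (suc n)       ≈⟨ pow-sucʳ (a ∙ b) n ⟩
      pow (a ∙ b) n ∙ (a ∙ b)   ≈⟨ ∙-congʳ (product-power n) ⟩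
      An ∙ Bn ∙ Cα ∙ Z ∙ (a ∙ b) ≈⟨ centre-shift (An ∙ Bn ∙ Cα) Z (a ∙ b) Z-central ⟩
      An ∙ Bn ∙ Cα ∙ (a ∙ b) ∙ Z ≈⟨ ∙-congʳ (solve 5 (λ P B C X Y → P ⊛ B ⊛ C ⊛ (X ⊛ Y) ⊜ P ⊛ (B ⊛ C ⊛ X) ⊛ Y) refl An Bn Cα a b) ⟩
      An ∙ (Bn ∙ Cα ∙ a) ∙ b ∙ Z ≈⟨ ∙-congʳ (∙-congʳ (∙-congˡ (step-past-a n))) ⟩
      An ∙ (a ∙ Bn ∙ Cs ∙ W) ∙ b ∙ Z
        ≈⟨ ∙-congʳ (solve 6 (λ P X B C V Y → P ⊛ (X ⊛ B ⊛ C ⊛ V) ⊛ Y ⊜ P ⊛ X ⊛ B ⊛ C ⊛ V ⊛ Y) refl An a Bn Cs W b) ⟩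
      An ∙ a ∙ Bn ∙ Cs ∙ W ∙ b ∙ Z ≈⟨ ∙-congʳ (centre-shift (An ∙ a ∙ Bn ∙ Cs) W b W-central) ⟩
      An ∙ a ∙ Bn ∙ Cs ∙ b ∙ W ∙ Z ≈⟨ ∙-congʳ (∙-congʳ (assoc (An ∙ a ∙ Bn) Cs b)) ⟩
      An ∙ a ∙ Bn ∙ (Cs ∙ b) ∙ W ∙ Z
        ≈⟨ ∙-congʳ (∙-congʳ (∙-congˡ (power-past c′ b e′ e-central (swap b c′) (binom₂ (suc n))))) ⟩
      An ∙ a ∙ Bn ∙ (b ∙ Cs ∙ Es) ∙ W ∙ Z
        ≈⟨ solve 8 (λ P X B Y C S V T → P ⊛ X ⊛ B ⊛ (Y ⊛ C ⊛ S) ⊛ V ⊛ T ⊜ (P ⊛ X) ⊛ (B ⊛ Y) ⊛ C ⊛ (S ⊛ (V ⊛ T)))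
                 refl An a Bn b Cs Es W Z ⟩
      (An ∙ a) ∙ (Bn ∙ b) ∙ Cs ∙ (Es ∙ (W ∙ Z))
        ≈⟨ ∙-cong (∙-congʳ (∙-cong (pow-sucʳ a n) (pow-sucʳ b n))) central-tail ⟨
      pow a (suc n) ∙ pow b (suc n) ∙ Cs ∙ (pow d′ (binom₃ (suc n)) ∙ pow e′ (mixed (suc n))) ∎
      where
      An = pow a n
      Bn = pow b n
      Cα = pow c′ (binom₂ n)
      Cs = pow c′ (binom₂ (suc n))
      Es = pow e′ (binom₂ (suc n))
      W = pow e′ (binom₂ n) ∙ pow d′ (binom₂ n)
      W-central = centre-∙ _ _ (centre-pow e′ (binom₂ n) e-central) (centre-pow d′ (binom₂ n) d-central)
      Z = pow d′ (binom₃ n) ∙ pow e′ (mixed n)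
      Z-central = centre-∙ _ _ (centre-pow d′ (binom₃ n) d-central) (centre-pow e′ (mixed n) e-central)
      central-tail : pow d′ (binom₃ (suc n)) ∙ pow e′ (mixed (suc n)) ≈ Es ∙ (W ∙ Z)
      central-tail = sym (central-step n)

    -- If moreover c, d, e have order dividing 5, then (ab)⁵ = a⁵ b⁵,
    -- because C(5,2) = C(5,3) = 10 and mixed 5 = 30 are multiples of 5.
    product-power-five : pow c′ 5 ≈ ε → pow d′ 5 ≈ ε → pow e′ 5 ≈ ε →
                         pow (a ∙ b) 5 ≈ pow a 5 ∙ pow b 5
    product-power-five c⁵ d⁵ e⁵ = begin
      pow (a ∙ b) 5                                            ≈⟨ product-power 5 ⟩
      pow a 5 ∙ pow b 5 ∙ pow c′ 10 ∙ (pow d′ 10 ∙ pow e′ 30)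
        ≈⟨ ∙-cong (∙-congˡ (vanish c′ 2 c⁵)) (∙-cong (vanish d′ 2 d⁵) (vanish e′ 6 e⁵)) ⟩
      pow a 5 ∙ pow b 5 ∙ ε ∙ (ε ∙ ε)                         ≈⟨ ∙-congˡ (identityʳ ε) ⟩
      pow a 5 ∙ pow b 5 ∙ ε ∙ ε                               ≈⟨ trans (identityʳ _) (identityʳ _) ⟩
      pow a 5 ∙ pow b 5                                        ∎
      where
      vanish : ∀ u k → pow u 5 ≈ ε → pow u (k * 5) ≈ ε
      vanish u k u⁵ = trans (pow-* u k 5) (trans (pow-cong k u⁵) (pow-ε k))

module CosetRelation {c ℓ : Level} (G : Group c ℓ) (Q : GroupDefs.Pred G) where
  open Group G
  open GroupDefs G
  open GroupFacts G
  open import Relation.Binary.Reasoning.Setoid setoid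
  open MonoidSolver monoid

  infix 4 _~_
  _~_ : Carrier → Carrier → Set _
  u ~ v = Gen Q (u ⁻¹ ∙ v)

  ~-reflexive : ∀ {u v} → u ≈ v → u ~ v
  ~-reflexive {u} u≈v = resp (trans (sym (inverseˡ u)) (∙-congˡ u≈v)) one

  ~-refl : ∀ {u} → u ~ u
  ~-refl = ~-reflexive refl

  ~-sym : ∀ {u v} → u ~ v → v ~ u
  ~-sym {u} {v} u~v = resp (trans (⁻¹-anti-homo-∙ (u ⁻¹) v) (∙-congˡ (⁻¹-involutive u))) (inv u~v)

  ~-trans : ∀ {u v z} → u ~ v → v ~ z → u ~ z
  ~-trans {u} {v} {z} u~v v~z = resp (trans (assoc (u ⁻¹) v _) (∙-congˡ (cancelˡ′ v z))) (mul u~v v~z)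

  -- (ab)⁻¹(a′b′) = b⁻¹(a⁻¹a′)b · b⁻¹b′.
  ~-∙ : ∀ {a a′ b b′} → (∀ {δ} → Gen Q δ → Gen Q (b ⁻¹ ∙ δ ∙ b)) →
        a ~ a′ → b ~ b′ → a ∙ b ~ a′ ∙ b′
  ~-∙ {a} {a′} {b} {b′} b-normalises a~a′ b~b′ = resp regroup (mul (b-normalises a~a′) b~b′)
    where
    regroup : b ⁻¹ ∙ (a ⁻¹ ∙ a′) ∙ b ∙ (b ⁻¹ ∙ b′) ≈ (a ∙ b) ⁻¹ ∙ (a′ ∙ b′)
    regroup = begin
      b ⁻¹ ∙ (a ⁻¹ ∙ a′) ∙ b ∙ (b ⁻¹ ∙ b′)
        ≈⟨ solve 5 (λ B′ A′ A B C → B′ ⊛ (A′ ⊛ A) ⊛ B ⊛ C ⊜ B′ ⊛ A′ ⊛ A ⊛ (B ⊛ C)) refl (b ⁻¹) (a ⁻¹) a′ b (b ⁻¹ ∙ b′) ⟩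
      b ⁻¹ ∙ a ⁻¹ ∙ a′ ∙ (b ∙ (b ⁻¹ ∙ b′)) ≈⟨ ∙-congˡ (cancelˡ′ b b′) ⟩
      b ⁻¹ ∙ a ⁻¹ ∙ a′ ∙ b′                ≈⟨ ∙-congʳ (∙-congʳ (⁻¹-anti-homo-∙ a b)) ⟨
      (a ∙ b) ⁻¹ ∙ a′ ∙ b′                 ≈⟨ assoc ((a ∙ b) ⁻¹) a′ b′ ⟩
      (a ∙ b) ⁻¹ ∙ (a′ ∙ b′)               ∎

  member~ε : ∀ {h} → Gen Q h → h ~ ε
  member~ε {h} h∈Q = resp (sym (identityʳ (h ⁻¹))) (inv h∈Q)

  ~-absorb : ∀ a {h} → Gen Q h → a ∙ h ~ a
  ~-absorb a {h} h∈Q = resp (sym (trans (∙-congʳ (⁻¹-anti-homo-∙ a h)) (cancelʳ′ a (h ⁻¹)))) (inv h∈Q)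

-- The abelianisation H/H′ of a subgroup H = ⟨P⟩, as a commutative monoid
-- whose elements are the members of H, compared modulo H′ = [H,H].
module Abelianisation {c ℓ : Level} (G : Group c ℓ) (P : GroupDefs.Pred G) where
  open Group G
  open GroupDefs G
  open GroupFacts G
  open CosetRelation G (Comms (Gen P) (Gen P)) public
  open import Relation.Binary.Reasoning.Setoid setoid

  H H′ : Pred
  H = Gen P
  H′ = Derived H

  comm∈H : ∀ {a b} → H a → H b → H ⁅ a , b ⁆
  comm∈H a∈H b∈H = mul (mul (mul (inv a∈H) (inv b∈H)) a∈H) b∈H

  H′⊆H : ∀ {u} → H′ u → H u
  H′⊆H (gen (a , b , a∈H , b∈H , u≈[a,b])) = resp (sym u≈[a,b]) (comm∈H a∈H b∈H)
  H′⊆H one = one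
  H′⊆H (inv u∈H′) = inv (H′⊆H u∈H′)
  H′⊆H (mul u∈H′ v∈H′) = mul (H′⊆H u∈H′) (H′⊆H v∈H′)
  H′⊆H (resp u≈v u∈H′) = resp u≈v (H′⊆H u∈H′)

  -- H′ is normal in H:  b⁻¹ δ b = δ [δ,b].
  H′-normal : ∀ {b} → H b → ∀ {δ} → H′ δ → H′ (b ⁻¹ ∙ δ ∙ b)
  H′-normal {b} b∈H {δ} δ∈H′ =
    resp (sym (conj-comm b δ)) (mul δ∈H′ (gen (δ , b , H′⊆H δ∈H′ , b∈H , refl)))

  Elt : Set _
  Elt = Σ Carrier H

  infix 4 _≋_
  record _≋_ (u v : Elt) : Set (c ⊔ ℓ) where
    constructor mod-H′
    field same-coset : proj₁ u ~ proj₁ v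
  open _≋_ public

  infixl 7 _⊙_
  _⊙_ : Elt → Elt → Elt
  (a , a∈H) ⊙ (b , b∈H) = (a ∙ b , mul a∈H b∈H)

  -- ab ≡ ba modulo H′, because (ab)⁻¹(ba) = [b,a].
  ⊙-comm : ∀ u v → (u ⊙ v) ≋ (v ⊙ u)
  ⊙-comm (a , a∈H) (b , b∈H) = mod-H′ (resp [b,a]≈ (gen (b , a , b∈H , a∈H , refl)))
    where
    [b,a]≈ : ⁅ b , a ⁆ ≈ (a ∙ b) ⁻¹ ∙ (b ∙ a)
    [b,a]≈ = trans (∙-congʳ (∙-congʳ (sym (⁻¹-anti-homo-∙ a b)))) (assoc ((a ∙ b) ⁻¹) b a)

  commutativeMonoid : CommutativeMonoid (c ⊔ ℓ) (c ⊔ ℓ)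
  commutativeMonoid = record
    { Carrier = Elt
    ; _≈_ = _≋_
    ; _∙_ = _⊙_
    ; ε = (ε , one)
    ; isCommutativeMonoid = record
      { isMonoid = record
        { isSemigroup = record
          { isMagma = record
            { isEquivalence = record
              { refl = mod-H′ ~-refl
              ; sym = λ (mod-H′ u~v) → mod-H′ (~-sym u~v)
              ; trans = λ (mod-H′ u~v) (mod-H′ v~z) → mod-H′ (~-trans u~v v~z) }
            ; ∙-cong = λ {_} {_} {b} (mod-H′ a~a′) (mod-H′ b~b′) →
                         mod-H′ (~-∙ (H′-normal (proj₂ b)) a~a′ b~b′) }
          ; assoc = λ _ _ _ → mod-H′ (~-reflexive (assoc _ _ _)) }
        ; identity = (λ _ → mod-H′ (~-reflexive (identityˡ _)))
                   , (λ _ → mod-H′ (~-reflexive (identityʳ _))) }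
      ; comm = ⊙-comm } }

module ProductFacts {c ℓ : Level} (G : Group c ℓ) where
  open Group G
  open GroupDefs G
  open GroupFacts G
  open import Relation.Binary.Reasoning.Setoid setoid
  open MonoidSolver monoid

  telescope : ∀ m (u : ℕ → Carrier) (z : Carrier) (f : Fin m → Carrier) →
              (∀ a → f a ≈ u (toℕ a) ⁻¹ ∙ z ∙ u (suc (toℕ a))) →
              prod f ≈ u 0 ⁻¹ ∙ pow z m ∙ u m
  telescope zero u z f _ = sym (trans (∙-congʳ (identityʳ (u 0 ⁻¹))) (inverseˡ (u 0)))
  telescope (suc m) u z f f≈ = begin
    f zero ∙ prod (f ∘ suc)
      ≈⟨ ∙-cong (f≈ zero) (telescope m (u ∘ suc) z (f ∘ suc) (f≈ ∘ suc)) ⟩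
    u 0 ⁻¹ ∙ z ∙ u 1 ∙ (u 1 ⁻¹ ∙ pow z m ∙ u (suc m))
      ≈⟨ solve 6 (λ U₀ Z U₁ U₁′ Q V → U₀ ⊛ Z ⊛ U₁ ⊛ (U₁′ ⊛ Q ⊛ V) ⊜ U₀ ⊛ Z ⊛ (U₁ ⊛ U₁′) ⊛ Q ⊛ V)
               refl (u 0 ⁻¹) z (u 1) (u 1 ⁻¹) (pow z m) (u (suc m)) ⟩
    u 0 ⁻¹ ∙ z ∙ (u 1 ∙ u 1 ⁻¹) ∙ pow z m ∙ u (suc m)
      ≈⟨ ∙-congʳ (∙-congʳ (∙-congˡ (inverseʳ (u 1)))) ⟩
    u 0 ⁻¹ ∙ z ∙ ε ∙ pow z m ∙ u (suc m)
      ≈⟨ solve 4 (λ U₀ Z Q V → U₀ ⊛ Z ⊛ id ⊛ Q ⊛ V ⊜ U₀ ⊛ (Z ⊛ Q) ⊛ V) refl (u 0 ⁻¹) z (pow z m) (u (suc m)) ⟩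
    u 0 ⁻¹ ∙ pow z (suc m) ∙ u (suc m) ∎

  -- Powers of one element w commute, so ∏ₖ (w^fₖ)⁻¹ w^hₖ = (w^Σf)⁻¹ w^Σh.
  prod-power-quotients : ∀ {m} w (f h : Fin m → ℕ) →
    prod (λ k → pow w (f k) ⁻¹ ∙ pow w (h k)) ≈ pow w (ℕSum.sum f) ⁻¹ ∙ pow w (ℕSum.sum h)
  prod-power-quotients {zero} w f h = sym (trans (identityʳ (ε ⁻¹)) ε⁻¹≈ε)
  prod-power-quotients {suc m} w f h = begin
    F₀ ∙ H₀ ∙ prod (λ k → pow w (f (suc k)) ⁻¹ ∙ pow w (h (suc k)))
      ≈⟨ ∙-congˡ (prod-power-quotients w (f ∘ suc) (h ∘ suc)) ⟩
    F₀ ∙ H₀ ∙ (Fₛ ∙ Hₛ)   ≈⟨ solve 4 (λ A B C D → A ⊛ B ⊛ (C ⊛ D) ⊜ A ⊛ (B ⊛ C) ⊛ D) refl F₀ H₀ Fₛ Hₛ ⟩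
    F₀ ∙ (H₀ ∙ Fₛ) ∙ Hₛ   ≈⟨ ∙-congʳ (∙-congˡ (comm-inv H₀ _ (pow-pow-comm w (h zero) (ℕSum.sum (f ∘ suc))))) ⟩
    F₀ ∙ (Fₛ ∙ H₀) ∙ Hₛ   ≈⟨ solve 4 (λ A B C D → A ⊛ (C ⊛ B) ⊛ D ⊜ (A ⊛ C) ⊛ (B ⊛ D)) refl F₀ H₀ Fₛ Hₛ ⟩
    (F₀ ∙ Fₛ) ∙ (H₀ ∙ Hₛ) ≈⟨ ∙-cong inverses (pow-+ w (h zero) (ℕSum.sum (h ∘ suc))) ⟨
    pow w (ℕSum.sum f) ⁻¹ ∙ pow w (ℕSum.sum h) ∎
    where
    F₀ = pow w (f zero) ⁻¹
    H₀ = pow w (h zero)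
    Fₛ = pow w (ℕSum.sum (f ∘ suc)) ⁻¹
    Hₛ = pow w (ℕSum.sum (h ∘ suc))
    inverses : pow w (ℕSum.sum f) ⁻¹ ≈ F₀ ∙ Fₛ
    inverses = begin
      pow w (f zero + ℕSum.sum (f ∘ suc)) ⁻¹             ≈⟨ ⁻¹-cong (pow-+ w (f zero) (ℕSum.sum (f ∘ suc))) ⟩
      (pow w (f zero) ∙ pow w (ℕSum.sum (f ∘ suc))) ⁻¹  ≈⟨ ⁻¹-cong (pow-pow-comm w (f zero) (ℕSum.sum (f ∘ suc))) ⟩
      (pow w (ℕSum.sum (f ∘ suc)) ∙ pow w (f zero)) ⁻¹  ≈⟨ ⁻¹-anti-homo-∙ _ _ ⟩
      F₀ ∙ Fₛ ∎

module NormalCosets {c ℓ : Level} (G : Group c ℓ) (P : GroupDefs.Pred G)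
                    (comm∈H : ∀ a b → GroupDefs.Gen G P (GroupDefs.⁅_,_⁆ G a b)) where
  open Group G
  open GroupDefs G
  open GroupFacts G
  open CosetRelation G P public
  open import Relation.Binary.Reasoning.Setoid setoid

  -- u⁻¹ m u = m [m,u].
  H-normal : ∀ u {m} → Gen P m → Gen P (u ⁻¹ ∙ m ∙ u)
  H-normal u {m} m∈H = resp (sym (conj-comm u m)) (mul m∈H (comm∈H m u))

  ~-∙-cong : ∀ {a a′ b b′} → a ~ a′ → b ~ b′ → a ∙ b ~ a′ ∙ b′
  ~-∙-cong {b = b} = ~-∙ (H-normal b)

  ~-pow : ∀ {u v} k → u ~ v → pow u k ~ pow v k
  ~-pow zero u~v = ~-refl
  ~-pow (suc k) u~v = ~-∙-cong u~v (~-pow k u~v)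

  reduce-exponent : ∀ w n .{{_ : NonZero n}} → Gen P (pow w n) →
                    ∀ e → pow w e ~ pow w (toℕ (DivMod.remainder (e divMod n)))
  reduce-exponent w n wⁿ∈H e = ~-trans (~-reflexive split-off) (~-absorb _ (gpow quotient wⁿ∈H))
    where
    open DivMod (e divMod n)
    gpow : ∀ {u} k → Gen P u → Gen P (pow u k)
    gpow zero _ = one
    gpow (suc k) u∈H = mul u∈H (gpow k u∈H)
    split-off : pow w e ≈ pow w (toℕ remainder) ∙ pow (pow w n) quotient
    split-off = begin
      pow w e                                      ≈⟨ pow-≡ w property ⟩
      pow w (toℕ remainder + quotient * n)          ≈⟨ pow-+ w (toℕ remainder) (quotient * n) ⟩
      pow w (toℕ remainder) ∙ pow w (quotient * n)  ≈⟨ ∙-congˡ (pow-* w quotient n) ⟩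
      pow w (toℕ remainder) ∙ pow (pow w n) quotient ∎

-- Writing tₖ = w^aₖ mₖ and g = w^E r (mₖ, r ∈ H), each factor
-- hₖ of the transfer splits as m_{σk}⁻¹ · Wₖ · (w^aₖ)⁻¹ r w^aₖ · mₖ with
-- Wₖ = (w^a_{σk})⁻¹ w^(E+aₖ) ∈ H.  Modulo H′ the m's cancel since σ permutes
-- the cosets, ∏ Wₖ = w^(nE) since k ↦ aₖ is a bijection as well, and
-- ∏ (w^a)⁻¹ r w^a telescopes to (r w⁻¹)ⁿ wⁿ = rⁿ.  Finally w^(nE) rⁿ = gⁿ.
module TransferPower {c ℓ : Level} (G : Group c ℓ) (P : GroupDefs.Pred G) where
  open Group G
  open GroupDefs G
  open GroupFacts G
  open ProductFacts G
  open Abelianisation G P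
  module HSum = CommutativeMonoidSum commutativeMonoid

  record PowerCoset (n : ℕ) (w u : Carrier) : Set (c ⊔ ℓ) where
    constructor power-coset
    field
      exponent : Fin n
      residue : Carrier
      residue∈H : H residue
      split : u ≈ pow w (toℕ exponent) ∙ residue

  prod-sum : ∀ {m} (f : Fin m → Elt) → proj₁ (HSum.sum f) ≡ prod (proj₁ ∘ f)
  prod-sum {zero} f = ≡.refl
  prod-sum {suc m} f = ≡.cong (proj₁ (f zero) ∙_) (prod-sum (f ∘ suc))

  transfer-resp : ∀ {n} {t : Fin n → Carrier} {g v v′} → v ≈ v′ → TransferIs H t g v → TransferIs H t g v′
  transfer-resp v≈v′ T σ hs hyp = resp (∙-congˡ v≈v′) (T σ hs hyp)

  module _ (comm∈H : ∀ a b → H ⁅ a , b ⁆) {n : ℕ} (w : Carrier)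
           (coset : ∀ u → PowerCoset n w u)
           (n-abelian : ∀ a b → pow (a ∙ b) n ≈ pow a n ∙ pow b n) where

    open NormalCosets G P comm∈H using (H-normal)

    module Computation
      (t : Fin n → Carrier)
      (distinct : ∀ k k′ h h′ → H h → H h′ → t k ∙ h ≈ t k′ ∙ h′ → k ≡ k′)
      (g : Carrier) (σ : Fin n → Fin n) (hs : Fin n → Carrier)
      (hyp : ∀ k → H (hs k) × (g ∙ t k ≈ t (σ k) ∙ hs k)) where
      open PowerCoset

      A : Fin n → Fin n
      A k = exponent (coset (t k))
      a : Fin n → ℕ
      a k = toℕ (A k)
      m : Fin n → Carrier
      m k = residue (coset (t k))
      E : ℕ
      E = toℕ (exponent (coset g))
      r : Carrier
      r = residue (coset g)

      W : Fin n → Carrier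
      W k = pow w (a (σ k)) ⁻¹ ∙ pow w (E + a k)
      N : Fin n → Carrier
      N j = pow w (toℕ j) ⁻¹ ∙ r ∙ pow w (toℕ j)

      module _ where
        open import Relation.Binary.Reasoning.Setoid setoid
        open MonoidSolver monoid

        -- σ and A are injective, because the tₖ lie in distinct cosets.
        σ-injective : Injective _≡_ _≡_ σ
        σ-injective {k} {k′} σk≡σk′ = distinct k k′ (hs k ⁻¹) (hs k′ ⁻¹)
          (inv (proj₁ (hyp k))) (inv (proj₁ (hyp k′)))
          (trans (t-hs⁻¹ k) (trans (∙-congˡ (reflexive (≡.cong t σk≡σk′))) (sym (t-hs⁻¹ k′))))
          where
          t-hs⁻¹ : ∀ k → t k ∙ hs k ⁻¹ ≈ g ⁻¹ ∙ t (σ k)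
          t-hs⁻¹ k = begin
            t k ∙ hs k ⁻¹                   ≈⟨ ∙-congʳ (cancelˡ g (t k)) ⟨
            g ⁻¹ ∙ (g ∙ t k) ∙ hs k ⁻¹       ≈⟨ ∙-congʳ (∙-congˡ (proj₂ (hyp k))) ⟩
            g ⁻¹ ∙ (t (σ k) ∙ hs k) ∙ hs k ⁻¹ ≈⟨ assoc (g ⁻¹) _ (hs k ⁻¹) ⟩
            g ⁻¹ ∙ (t (σ k) ∙ hs k ∙ hs k ⁻¹) ≈⟨ ∙-congˡ (cancelʳ (hs k) (t (σ k))) ⟩
            g ⁻¹ ∙ t (σ k)                   ∎

        A-injective : Injective _≡_ _≡_ A
        A-injective {k} {k′} Ak≡Ak′ = distinct k k′ (m k ⁻¹) (m k′ ⁻¹)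
          (inv (residue∈H (coset (t k)))) (inv (residue∈H (coset (t k′))))
          (trans (t-m⁻¹ k) (trans (pow-≡ w (≡.cong toℕ Ak≡Ak′)) (sym (t-m⁻¹ k′))))
          where
          t-m⁻¹ : ∀ k → t k ∙ m k ⁻¹ ≈ pow w (a k)
          t-m⁻¹ k = trans (∙-congʳ (split (coset (t k)))) (cancelʳ (m k) (pow w (a k)))

        factorisation : ∀ k → hs k ≈ m (σ k) ⁻¹ ∙ W k ∙ N (A k) ∙ m k
        factorisation k = sym (begin
          mσ ⁻¹ ∙ (Pσ ⁻¹ ∙ pow w (E + a k)) ∙ (Pk ⁻¹ ∙ r ∙ Pk) ∙ mk
            ≈⟨ ∙-congʳ (∙-congʳ (∙-congˡ (∙-congˡ (pow-+ w E (a k))))) ⟩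
          mσ ⁻¹ ∙ (Pσ ⁻¹ ∙ (WE ∙ Pk)) ∙ (Pk ⁻¹ ∙ r ∙ Pk) ∙ mk
            ≈⟨ solve 8 (λ M′ P′ X Q Q′ R Q₂ M → M′ ⊛ (P′ ⊛ (X ⊛ Q)) ⊛ (Q′ ⊛ R ⊛ Q₂) ⊛ M ⊜ M′ ⊛ P′ ⊛ X ⊛ (Q ⊛ Q′) ⊛ R ⊛ Q₂ ⊛ M)
                     refl (mσ ⁻¹) (Pσ ⁻¹) WE Pk (Pk ⁻¹) r Pk mk ⟩
          mσ ⁻¹ ∙ Pσ ⁻¹ ∙ WE ∙ (Pk ∙ Pk ⁻¹) ∙ r ∙ Pk ∙ mk
            ≈⟨ ∙-congʳ (∙-congʳ (∙-congʳ (∙-congˡ (inverseʳ Pk)))) ⟩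
          mσ ⁻¹ ∙ Pσ ⁻¹ ∙ WE ∙ ε ∙ r ∙ Pk ∙ mk
            ≈⟨ solve 6 (λ M′ P′ X R Q M → M′ ⊛ P′ ⊛ X ⊛ id ⊛ R ⊛ Q ⊛ M ⊜ (M′ ⊛ P′) ⊛ ((X ⊛ R) ⊛ (Q ⊛ M)))
                     refl (mσ ⁻¹) (Pσ ⁻¹) WE r Pk mk ⟩
          (mσ ⁻¹ ∙ Pσ ⁻¹) ∙ ((WE ∙ r) ∙ (Pk ∙ mk))
            ≈⟨ ∙-cong (⁻¹-anti-homo-∙ Pσ mσ) (∙-cong (split (coset g)) (split (coset (t k)))) ⟨
          (Pσ ∙ mσ) ⁻¹ ∙ (g ∙ t k)
            ≈⟨ ∙-congʳ (⁻¹-cong (split (coset (t (σ k))))) ⟨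
          t (σ k) ⁻¹ ∙ (g ∙ t k)         ≈⟨ ∙-congˡ (proj₂ (hyp k)) ⟩
          t (σ k) ⁻¹ ∙ (t (σ k) ∙ hs k)   ≈⟨ cancelˡ (t (σ k)) (hs k) ⟩
          hs k                            ∎)
          where
          mσ = m (σ k)
          mk = m k
          Pσ = pow w (a (σ k))
          Pk = pow w (a k)
          WE = pow w E

        -- Solving the factorisation for Wₖ shows Wₖ ∈ H.
        W∈H : ∀ k → H (W k)
        W∈H k = resp isolate
          (mul (mul (mul (residue∈H (coset (t (σ k)))) (proj₁ (hyp k))) (inv (residue∈H (coset (t k)))))
               (inv (H-normal (pow w (a k)) (residue∈H (coset g)))))
          where
          isolate : m (σ k) ∙ hs k ∙ m k ⁻¹ ∙ N (A k) ⁻¹ ≈ W k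
          isolate = begin
            mσ ∙ hs k ∙ mk ⁻¹ ∙ Nk ⁻¹
              ≈⟨ ∙-congʳ (∙-congʳ (∙-congˡ (factorisation k))) ⟩
            mσ ∙ (mσ ⁻¹ ∙ W k ∙ Nk ∙ mk) ∙ mk ⁻¹ ∙ Nk ⁻¹
              ≈⟨ solve 7 (λ M M′ X Y K K′ Y′ → M ⊛ (M′ ⊛ X ⊛ Y ⊛ K) ⊛ K′ ⊛ Y′ ⊜ M ⊛ (M′ ⊛ (X ⊛ Y ⊛ K ⊛ K′ ⊛ Y′)))
                       refl mσ (mσ ⁻¹) (W k) Nk mk (mk ⁻¹) (Nk ⁻¹) ⟩
            mσ ∙ (mσ ⁻¹ ∙ (W k ∙ Nk ∙ mk ∙ mk ⁻¹ ∙ Nk ⁻¹)) ≈⟨ cancelˡ′ mσ _ ⟩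
            W k ∙ Nk ∙ mk ∙ mk ⁻¹ ∙ Nk ⁻¹                  ≈⟨ ∙-congʳ (cancelʳ mk (W k ∙ Nk)) ⟩
            W k ∙ Nk ∙ Nk ⁻¹                               ≈⟨ cancelʳ Nk (W k) ⟩
            W k                                            ∎
            where
            mσ = m (σ k)
            mk = m k
            Nk = N (A k)

        -- ∏ Wₖ = (w^Σa∘σ)⁻¹ w^(nE + Σa) = w^(nE), as a ∘ σ is a rearrangement of a.
        prod-W : prod W ≈ pow w (n * E)
        prod-W = begin
          prod W                              ≈⟨ prod-power-quotients w (a ∘ σ) (λ k → E + a k) ⟩
          pow w (ℕSum.sum (a ∘ σ)) ⁻¹ ∙ pow w (ℕSum.sum (λ k → E + a k))
            ≈⟨ ∙-cong (⁻¹-cong (pow-≡ w (≡.sym (Reindex.sum-reindex ℕ.+-0-commutativeMonoid a σ σ-injective))))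
                      (pow-≡ w (sum-shift E a)) ⟩
          pow w S ⁻¹ ∙ pow w (n * E + S)       ≈⟨ ∙-congˡ (trans (pow-+ w (n * E) S) (pow-pow-comm w (n * E) S)) ⟩
          pow w S ⁻¹ ∙ (pow w S ∙ pow w (n * E)) ≈⟨ cancelˡ (pow w S) (pow w (n * E)) ⟩
          pow w (n * E)                         ∎
          where
          S = ℕSum.sum a

        -- ∏ⱼ (wʲ)⁻¹ r wʲ = ∏ⱼ (wʲ)⁻¹ (r w⁻¹) wʲ⁺¹ = (r w⁻¹)ⁿ wⁿ = rⁿ.
        prod-N : prod N ≈ pow r n
        prod-N = begin
          prod N                               ≈⟨ telescope n (pow w) (r ∙ w ⁻¹) N (conj-as-step ∘ toℕ) ⟩
          ε ⁻¹ ∙ pow (r ∙ w ⁻¹) n ∙ pow w n     ≈⟨ ∙-congʳ (trans (∙-congʳ ε⁻¹≈ε) (identityˡ _)) ⟩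
          pow (r ∙ w ⁻¹) n ∙ pow w n            ≈⟨ ∙-congʳ (trans (n-abelian r (w ⁻¹)) (∙-congˡ (pow-inv w n))) ⟩
          pow r n ∙ pow w n ⁻¹ ∙ pow w n         ≈⟨ cancelʳ′ (pow w n) (pow r n) ⟩
          pow r n                               ∎
          where
          conj-as-step : ∀ i → pow w i ⁻¹ ∙ r ∙ pow w i ≈ pow w i ⁻¹ ∙ (r ∙ w ⁻¹) ∙ pow w (suc i)
          conj-as-step i = sym (begin
            pow w i ⁻¹ ∙ (r ∙ w ⁻¹) ∙ (w ∙ pow w i)
              ≈⟨ solve 5 (λ P′ R W′ X P → P′ ⊛ (R ⊛ W′) ⊛ (X ⊛ P) ⊜ P′ ⊛ R ⊛ (W′ ⊛ X) ⊛ P)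
                       refl (pow w i ⁻¹) r (w ⁻¹) w (pow w i) ⟩
            pow w i ⁻¹ ∙ r ∙ (w ⁻¹ ∙ w) ∙ pow w i ≈⟨ ∙-congʳ (∙-congˡ (inverseˡ w)) ⟩
            pow w i ⁻¹ ∙ r ∙ ε ∙ pow w i         ≈⟨ ∙-congʳ (identityʳ _) ⟩
            pow w i ⁻¹ ∙ r ∙ pow w i             ∎)

        power-of-g : pow w (n * E) ∙ pow r n ≈ pow g n
        power-of-g = begin
          pow w (n * E) ∙ pow r n     ≈⟨ ∙-congʳ (pow-* w n E) ⟩
          pow (pow w E) n ∙ pow r n   ≈⟨ n-abelian (pow w E) r ⟨
          pow (pow w E ∙ r) n         ≈⟨ pow-cong n (split (coset g)) ⟨
          pow g n                     ∎

      hsᴱ m⁻¹ᴱ mᴱ Wᴱ Nᴱ : Fin n → Elt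
      hsᴱ k = (hs k , proj₁ (hyp k))
      m⁻¹ᴱ k = (m k ⁻¹ , inv (residue∈H (coset (t k))))
      mᴱ k = (m k , residue∈H (coset (t k)))
      Wᴱ k = (W k , W∈H k)
      Nᴱ j = (N j , H-normal (pow w (toℕ j)) (residue∈H (coset g)))

      module _ where
        module HM = CommutativeMonoid commutativeMonoid
        open import Relation.Binary.Reasoning.Setoid HM.setoid
        open HSum using (sum; ∑-distrib-+; sum-cong-≋; sum-replicate-zero)
        open Reindex commutativeMonoid using (sum-reindex)
        open import Algebra.Solver.CommutativeMonoid commutativeMonoid using (solve; _⊜_; _⊕_)

        -- In H/H′:  Σ hₖ = Σ m_{σk}⁻¹ + Σ Wₖ + Σ N_{Aₖ} + Σ mₖ = Σ Wₖ + Σⱼ Nⱼ.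
        sum-hs : sum hsᴱ ≋ sum Wᴱ ⊙ sum Nᴱ
        sum-hs = begin
          sum hsᴱ
            ≈⟨ sum-cong-≋ (λ k → mod-H′ (~-reflexive (factorisation k))) ⟩
          sum (λ k → m⁻¹ᴱ (σ k) ⊙ Wᴱ k ⊙ Nᴱ (A k) ⊙ mᴱ k)
            ≈⟨ HM.trans (∑-distrib-+ _ mᴱ) (HM.∙-congʳ (HM.trans (∑-distrib-+ _ (Nᴱ ∘ A)) (HM.∙-congʳ (∑-distrib-+ (m⁻¹ᴱ ∘ σ) Wᴱ)))) ⟩
          sum (m⁻¹ᴱ ∘ σ) ⊙ sum Wᴱ ⊙ sum (Nᴱ ∘ A) ⊙ sum mᴱ
            ≈⟨ HM.∙-congʳ (⊙-cong₃ (HM.sym (sum-reindex m⁻¹ᴱ σ σ-injective)) (HM.sym (sum-reindex Nᴱ A A-injective))) ⟩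
          sum m⁻¹ᴱ ⊙ sum Wᴱ ⊙ sum Nᴱ ⊙ sum mᴱ
            ≈⟨ solve 4 (λ X Y Z U → ((X ⊕ Y) ⊕ Z) ⊕ U ⊜ (X ⊕ U) ⊕ (Y ⊕ Z)) HM.refl (sum m⁻¹ᴱ) (sum Wᴱ) (sum Nᴱ) (sum mᴱ) ⟩
          (sum m⁻¹ᴱ ⊙ sum mᴱ) ⊙ (sum Wᴱ ⊙ sum Nᴱ)
            ≈⟨ HM.∙-congʳ residues-cancel ⟩
          (ε , one) ⊙ (sum Wᴱ ⊙ sum Nᴱ)
            ≈⟨ HM.identityˡ _ ⟩
          sum Wᴱ ⊙ sum Nᴱ ∎
          where
          ⊙-cong₃ : ∀ {x x′ y z z′} → x ≋ x′ → z ≋ z′ → x ⊙ y ⊙ z ≋ x′ ⊙ y ⊙ z′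
          ⊙-cong₃ x≋x′ z≋z′ = HM.∙-cong (HM.∙-congʳ x≋x′) z≋z′
          residues-cancel : sum m⁻¹ᴱ ⊙ sum mᴱ ≋ (ε , one)
          residues-cancel = begin
            sum m⁻¹ᴱ ⊙ sum mᴱ           ≈⟨ HM.sym (∑-distrib-+ m⁻¹ᴱ mᴱ) ⟩
            sum (λ k → m⁻¹ᴱ k ⊙ mᴱ k)   ≈⟨ sum-cong-≋ (λ k → mod-H′ (~-reflexive (inverseˡ (m k)))) ⟩
            sum {n} (λ _ → (ε , one))   ≈⟨ sum-replicate-zero n ⟩
            (ε , one)                   ∎

      transfer≡power : H′ (prod hs ⁻¹ ∙ pow g n)
      transfer≡power = resp evaluate (same-coset sum-hs)
        where
        open import Relation.Binary.Reasoning.Setoid setoid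
        evaluate : proj₁ (HSum.sum hsᴱ) ⁻¹ ∙ (proj₁ (HSum.sum Wᴱ) ∙ proj₁ (HSum.sum Nᴱ)) ≈ prod hs ⁻¹ ∙ pow g n
        evaluate = begin
          proj₁ (HSum.sum hsᴱ) ⁻¹ ∙ (proj₁ (HSum.sum Wᴱ) ∙ proj₁ (HSum.sum Nᴱ))
            ≡⟨ ≡.cong₂ (λ u v → u ⁻¹ ∙ v) (prod-sum hsᴱ) (≡.cong₂ _∙_ (prod-sum Wᴱ) (prod-sum Nᴱ)) ⟩
          prod hs ⁻¹ ∙ (prod W ∙ prod N)            ≈⟨ ∙-congˡ (∙-cong prod-W prod-N) ⟩
          prod hs ⁻¹ ∙ (pow w (n * E) ∙ pow r n)    ≈⟨ ∙-congˡ power-of-g ⟩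
          prod hs ⁻¹ ∙ pow g n                      ∎

    transfer-is-power : (t : Fin n → Carrier) → IsLeftTransversal H t →
                        ∀ g → TransferIs H t g (pow g n)
    transfer-is-power t (_ , distinct) g σ hs hyp =
      Computation.transfer≡power t distinct g σ hs hyp

module Φ₆Stem {c ℓ : Level} (G : Group c ℓ) (x y : Group.Carrier G) (S : GroupDefs.IsΦ₆Stem5 G x y) where
  open Group G
  open GroupDefs G
  open GroupFacts G
  open IsΦ₆Stem5 S
  open import Relation.Binary.Reasoning.Setoid setoid

  commutator∈γ₂ : ∀ a b → γ₂ ⁅ a , b ⁆
  commutator∈γ₂ a b = gen (a , b , lift tt , lift tt , refl)

  -- [u,a] ∈ γ₃ = ζ₁(G) for u ∈ G′, and G′ has exponent 5.
  γ₃-central : ∀ u a → γ₂ u → Centre ⁅ u , a ⁆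
  γ₃-central u a u∈γ₂ = proj₂ (centre ⁅ u , a ⁆) (gen (u , a , u∈γ₂ , lift tt , refl))

  commutator⁵ : ∀ a b → pow ⁅ a , b ⁆ 5 ≈ ε
  commutator⁵ a b = proj₁ (proj₂ γ₂-C5³) ⁅ a , b ⁆ (commutator∈γ₂ a b)

  five-abelian : ∀ a b → pow (a ∙ b) 5 ≈ pow a 5 ∙ pow b 5
  five-abelian a b = ClassThreePowers.product-power-five G a b
    (γ₃-central ⁅ b , a ⁆ a (commutator∈γ₂ b a)) (γ₃-central ⁅ b , a ⁆ b (commutator∈γ₂ b a))
    (commutator⁵ b a) (commutator⁵ ⁅ b , a ⁆ a) (commutator⁵ ⁅ b , a ⁆ b)

  Pᵢ : Fin 6 → Pred
  Pᵢ i a = Is (maxGen x y i) a ⊎ γ₂ a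

  comm∈Hᵢ : ∀ i a b → Gen (Pᵢ i) ⁅ a , b ⁆
  comm∈Hᵢ i a b = gen (inj₂ (commutator∈γ₂ a b))

  module Cosets (i : Fin 6) = NormalCosets G (Pᵢ i) (comm∈Hᵢ i)

  -- ... and a generator wᵢ of the cyclic quotient G/Hᵢ of order 5, with x ≡ wᵢ^(x-exp i)
  -- and y ≡ wᵢ^(y-exp i) modulo Hᵢ:  for H₁ = ⟨y,G′⟩ take w = x, and for
  -- Hᵢ = ⟨x yʳ, G′⟩ take w = y, where x ≡ y⁻ʳ ≡ y^(5-r).
  w : Fin 6 → Carrier
  w zero = x
  w (suc _) = y

  x-exp y-exp : Fin 6 → ℕ
  x-exp zero = 1
  x-exp (suc r) = 5 ∸ toℕ r
  y-exp zero = 0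
  y-exp (suc r) = 1

  w⁵∈Hᵢ : ∀ i → Gen (Pᵢ i) (pow (w i) 5)
  w⁵∈Hᵢ zero = gen (inj₂ x⁵∈G')
  w⁵∈Hᵢ (suc r) = gen (inj₂ y⁵∈G')

  x≡power : ∀ i → Cosets._~_ i x (pow (w i) (x-exp i))
  x≡power zero = Cosets.~-reflexive zero (sym (identityʳ x))
  x≡power (suc r) =
    ~-trans (~-reflexive x≈z∙y⁻ʳ) (~-trans (~-∙-cong z~ε ~-refl) (~-trans (~-reflexive (identityˡ _)) y⁻ʳ~y⁵⁻ʳ))
    where
    open Cosets (suc r)
    R = toℕ r
    z = maxGen x y (suc r)
    x≈z∙y⁻ʳ : x ≈ z ∙ pow y R ⁻¹
    x≈z∙y⁻ʳ = sym (cancelʳ (pow y R) x)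
    z~ε : z ~ ε
    z~ε = member~ε (gen (inj₁ (lift refl)))
    y⁻ʳ~y⁵⁻ʳ : pow y R ⁻¹ ~ pow y (5 ∸ R)
    y⁻ʳ~y⁵⁻ʳ = resp (sym (begin
      pow y R ⁻¹ ⁻¹ ∙ pow y (5 ∸ R) ≈⟨ ∙-congʳ (⁻¹-involutive (pow y R)) ⟩
      pow y R ∙ pow y (5 ∸ R)       ≈⟨ pow-+ y R (5 ∸ R) ⟨
      pow y (R + (5 ∸ R))           ≡⟨ ≡.cong (pow y) (ℕ.m+[n∸m]≡n (ℕ.<⇒≤ (toℕ<n r))) ⟩
      pow y 5                       ∎)) (gen (inj₂ y⁵∈G'))

  y≡power : ∀ i → Cosets._~_ i y (pow (w i) (y-exp i))
  y≡power zero = Cosets.member~ε zero (gen (inj₁ (lift refl)))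
  y≡power (suc r) = Cosets.~-reflexive (suc r) (sym (identityʳ y))

  -- Every u ∈ G lies in a coset wᵢᵃ Hᵢ with a < 5: by the abelianisation
  -- u ≡ xᴶ yᴸ ≡ wᵢ^(J·x-exp + L·y-exp) modulo Hᵢ ⊇ G′, and wᵢ⁵ ∈ Hᵢ.
  coset-of : ∀ i u → TransferPower.PowerCoset G (Pᵢ i) 5 (w i) u
  coset-of i u with abelianisation u
  ... | J , L , xᴶyᴸ≡u = TransferPower.power-coset a (pow (w i) (toℕ a) ⁻¹ ∙ u) wᵃ~u
                          (sym (cancelˡ′ (pow (w i) (toℕ a)) u))
    where
    open Cosets i
    e = toℕ J * x-exp i + toℕ L * y-exp i
    a = DivMod.remainder (e divMod 5)
    wᵉ~xᴶyᴸ : pow (w i) e ~ pow x (toℕ J) ∙ pow y (toℕ L)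
    wᵉ~xᴶyᴸ = ~-trans (~-reflexive (begin
      pow (w i) e                                                 ≈⟨ pow-+ (w i) (toℕ J * x-exp i) _ ⟩
      pow (w i) (toℕ J * x-exp i) ∙ pow (w i) (toℕ L * y-exp i)   ≈⟨ ∙-cong (pow-* (w i) (toℕ J) _) (pow-* (w i) (toℕ L) _) ⟩
      pow (pow (w i) (x-exp i)) (toℕ J) ∙ pow (pow (w i) (y-exp i)) (toℕ L) ∎))
      (~-∙-cong (~-pow (toℕ J) (~-sym (x≡power i))) (~-pow (toℕ L) (~-sym (y≡power i))))
    wᵃ~u : pow (w i) (toℕ a) ~ u
    wᵃ~u = ~-trans (~-sym (reduce-exponent (w i) 5 (w⁵∈Hᵢ i) e))
                   (~-trans wᵉ~xᴶyᴸ (gen (inj₂ xᴶyᴸ≡u)))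

  transfer-value : ∀ i (t : Fin 5 → Carrier) → IsLeftTransversal (MaxSub x y i) t → ∀ j l →
    TransferIs (MaxSub x y i) t (pow x j ∙ pow y l) (pow x (5 * j) ∙ pow y (5 * l))
  transfer-value i t T j l =
    transfer-resp fifth-power
      (transfer-is-power (comm∈Hᵢ i) (w i) (coset-of i) five-abelian t T (pow x j ∙ pow y l))
    where
    open TransferPower G (Pᵢ i)
    fifth-power : pow (pow x j ∙ pow y l) 5 ≈ pow x (5 * j) ∙ pow y (5 * l)
    fifth-power = trans (five-abelian (pow x j) (pow y l)) (sym (∙-cong (pow-* x 5 j) (pow-* y 5 l)))

lemma3p2 : ∀ {c ℓ : Level} (G : Group c ℓ) → let open Group G in let open GroupDefs G in
    (x y : Carrier) → IsΦ₆Stem5 x y →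
    (i : Fin 6) (t : Fin 5 → Carrier) → IsLeftTransversal (MaxSub x y i) t →
    (j ℓ′ : Fin 5) →
    TransferIs (MaxSub x y i) t (pow x (toℕ j) ∙ pow y (toℕ ℓ′))
      (pow x (5 * toℕ j) ∙ pow y (5 * toℕ ℓ′))
lemma3p2 G x y S i t T j ℓ′ = Φ₆Stem.transfer-value G x y S i t T (toℕ j) (toℕ ℓ′)
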